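{- If $G$ is a graph with $\chi_i(G)=\Delta(G)$, then $G$ is a Class 1 graph, i.e., $\chi'(G)=\Delta(G)$.
   Context: All graphs are finite and simple. An injective $k$-coloring of $G$ is a map $f:V(G)\to\{1,\dots,k\}$ such that no vertex has two neighbors $u\neq w$ with $f(u)=f(w)$; $\chi_i(G)$ is the least $k$ for which an injective $k$-coloring exists. $\Delta(G)$ is the maximum degree and $\chi'(G)$ the chromatic index (edge-chromatic number); $G$ is Class 1 if $\chi'(G)=\Delta(G)$. -}

module Defs where

open import Data.Nat using (ℕ; _≤_; _⊔_)
open import Data.Fin using (Fin)
open import Data.Bool using (Bool; true; false; T; if_then_else_)
open import Data.List using (List; map; foldr; allFin)
open import Data.Nat.ListAction using (sum)
open import Data.Product using (Σ; ∃; _×_)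
open import Relation.Binary.PropositionalEquality using (_≡_)
open import Relation.Nullary using (¬_)

record Graph (n : ℕ) : Set where
  field
    adj   : Fin n → Fin n → Bool
    sym   : ∀ u v → adj u v ≡ adj v u
    irrefl : ∀ u → adj u u ≡ false
open Graph public

Adj : ∀ {n} → Graph n → Fin n → Fin n → Set
Adj G u v = T (adj G u v)

degree : ∀ {n} → Graph n → Fin n → ℕ
degree {n} G u = sum (map (λ v → if adj G u v then 1 else 0) (allFin n))

maxDegree : ∀ {n} → Graph n → ℕ
maxDegree {n} G = foldr _⊔_ 0 (map (degree G) (allFin n))

IsInjectiveColoring : ∀ {n} → Graph n → (k : ℕ) → (Fin n → Fin k) → Set
IsInjectiveColoring G k c =
  ∀ u v w → Adj G u v → Adj G u w → c v ≡ c w → v ≡ w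

InjColorable : ∀ {n} → Graph n → ℕ → Set
InjColorable {n} G k = Σ (Fin n → Fin k) (IsInjectiveColoring G k)

InjChromaticNumberIs : ∀ {n} → Graph n → ℕ → Set
InjChromaticNumberIs G k = InjColorable G k × (∀ m → InjColorable G m → k ≤ m)

-- proper edge k-colouring, given as a colour for each ordered pair, required to be
-- symmetric on edges; edges sharing an endpoint receive different colours
IsProperEdgeColoring : ∀ {n} → Graph n → (k : ℕ) → (Fin n → Fin n → Fin k) → Set
IsProperEdgeColoring G k f =
  (∀ u v → Adj G u v → f u v ≡ f v u) ×
  (∀ u v w → Adj G u v → Adj G u w → f u v ≡ f u w → v ≡ w)

EdgeColorable : ∀ {n} → Graph n → ℕ → Set
EdgeColorable {n} G k = Σ (Fin n → Fin n → Fin k) (IsProperEdgeColoring G k)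

ChromaticIndexIs : ∀ {n} → Graph n → ℕ → Set
ChromaticIndexIs G k = EdgeColorable G k × (∀ m → EdgeColorable G m → k ≤ m)

Class1 : ∀ {n} → Graph n → Set
Class1 G = ChromaticIndexIs G (maxDegree G)

-- Colour each edge uv by c(u) + c(v) mod k, where c is an injective k-colouring.
-- Two edges uv and uw at u then get the same colour only if c(v) = c(w), which
-- injectivity of c forbids for distinct neighbours v, w of u; so χ'(G) ≤ χᵢ(G).
-- Conversely the edges at a vertex of maximum degree need Δ(G) distinct colours.
module Submission where

open import Defs hiding (sym)
open import Data.Bool using (Bool; true; false; T; if_then_else_)
open import Data.Bool.Properties using (T-≡)
open import Data.Fin using (Fin; zero; suc; toℕ; punchOut)
open import Data.Fin.Properties
  using (toℕ<n; toℕ-injective; toℕ-fromℕ<; suc-injective; punchOut-injective; ¬Fin0)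
open import Data.List using (map; tabulate)
open import Data.List.Properties using (foldr-preservesᵇ)
open import Data.List.Relation.Unary.All.Properties using (map⁺; tabulate⁺)
open import Data.Nat using (ℕ; zero; suc; _+_; _∸_; _%_; _≤_; _<_; z≤n; s≤s; NonZero)
open import Data.Nat.DivMod
  using (_mod_; %-distribˡ-+; m%n%n≡m%n; [m+n]%n≡m%n; m<n⇒m%n≡m)
open import Data.Nat.ListAction using (sum)
open import Data.Nat.Properties
  using (+-0-monoid; +-assoc; +-comm; m∸n+n≡m; <⇒≤; ⊔-lub; module ≤-Reasoning)
open import Algebra.Properties.Monoid.Sum +-0-monoid using (sum-syntax)
open import Data.Product using (_,_)
open import Function using (_∘_; id)
open import Function.Bundles using (Equivalence)
open import Relation.Binary.PropositionalEquality
  using (_≡_; _≢_; refl; sym; trans; cong; module ≡-Reasoning)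
open import Relation.Nullary using (contradiction)

[m+n%d]%d≡[m+n]%d : ∀ m n d .{{_ : NonZero d}} → (m + n % d) % d ≡ (m + n) % d
[m+n%d]%d≡[m+n]%d m n d = begin
  (m + n % d) % d          ≡⟨ %-distribˡ-+ m (n % d) d ⟩
  (m % d + n % d % d) % d  ≡⟨ cong (λ x → (m % d + x) % d) (m%n%n≡m%n n d) ⟩
  (m % d + n % d) % d      ≡⟨ %-distribˡ-+ m n d ⟨
  (m + n) % d              ∎
  where open ≡-Reasoning

[d∸a+[a+b]%d]%d≡b : ∀ {a b d} .{{_ : NonZero d}} → a ≤ d → b < d →
                    (d ∸ a + (a + b) % d) % d ≡ b
[d∸a+[a+b]%d]%d≡b {a} {b} {d} a≤d b<d = begin
  (d ∸ a + (a + b) % d) % d  ≡⟨ [m+n%d]%d≡[m+n]%d (d ∸ a) (a + b) d ⟩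
  (d ∸ a + (a + b)) % d      ≡⟨ cong (_% d) (+-assoc (d ∸ a) a b) ⟨
  (d ∸ a + a + b) % d        ≡⟨ cong (λ x → (x + b) % d) (m∸n+n≡m a≤d) ⟩
  (d + b) % d                ≡⟨ cong (_% d) (+-comm d b) ⟩
  (b + d) % d                ≡⟨ [m+n]%n≡m%n b d ⟩
  b % d                      ≡⟨ m<n⇒m%n≡m b<d ⟩
  b                          ∎
  where open ≡-Reasoning

+-%-cancelˡ : ∀ {a b c d} .{{_ : NonZero d}} → a ≤ d → b < d → c < d →
              (a + b) % d ≡ (a + c) % d → b ≡ c
+-%-cancelˡ {a} {b} {c} {d} a≤d b<d c<d eq = begin
  b                          ≡⟨ [d∸a+[a+b]%d]%d≡b a≤d b<d ⟨
  (d ∸ a + (a + b) % d) % d  ≡⟨ cong (λ x → (d ∸ a + x) % d) eq ⟩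
  (d ∸ a + (a + c) % d) % d  ≡⟨ [d∸a+[a+b]%d]%d≡b a≤d c<d ⟩
  c                          ∎
  where open ≡-Reasoning

infixl 6 _⊕_

_⊕_ : ∀ {k} → Fin k → Fin k → Fin k
_⊕_ {suc k} i j = (toℕ i + toℕ j) mod suc k

toℕ-⊕ : ∀ {k} (i j : Fin (suc k)) → toℕ (i ⊕ j) ≡ (toℕ i + toℕ j) % suc k
toℕ-⊕ i j = toℕ-fromℕ< _

⊕-comm : ∀ {k} (i j : Fin k) → i ⊕ j ≡ j ⊕ i
⊕-comm {suc k} i j = cong (_mod suc k) (+-comm (toℕ i) (toℕ j))

⊕-cancelˡ : ∀ {k} (i : Fin k) {j l : Fin k} → i ⊕ j ≡ i ⊕ l → j ≡ l
⊕-cancelˡ {suc k} i {j} {l} eq = toℕ-injective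
  (+-%-cancelˡ (<⇒≤ (toℕ<n i)) (toℕ<n j) (toℕ<n l)
    (trans (sym (toℕ-⊕ i j)) (trans (cong toℕ eq) (toℕ-⊕ i l))))

injColorable⇒edgeColorable : ∀ {n k} (G : Graph n) → InjColorable G k → EdgeColorable G k
injColorable⇒edgeColorable G (c , injective) =
  (λ u v → c u ⊕ c v) ,
  (λ u v _ → ⊕-comm (c u) (c v)) ,
  (λ u v w uv uw eq → injective u v w uv uw (⊕-cancelˡ (c u) eq))

sum-map-tabulate : ∀ {n} {A : Set} (f : A → ℕ) (g : Fin n → A) →
                   sum (map f (tabulate g)) ≡ ∑[ i < n ] f (g i)
sum-map-tabulate {zero}  f g = refl
sum-map-tabulate {suc n} f g = cong (f (g zero) +_) (sum-map-tabulate f (g ∘ suc))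

injective⇒count≤ : ∀ {n m} (p : Fin n → Bool) (g : ∀ v → T (p v) → Fin m) →
                   (∀ {v w} pv pw → g v pv ≡ g w pw → v ≡ w) →
                   ∑[ v < n ] (if p v then 1 else 0) ≤ m
injective⇒count≤ {zero}  p g injective = z≤n
injective⇒count≤ {suc n} p g injective with p zero in p₀
... | false = injective⇒count≤ (p ∘ suc) (g ∘ suc) (λ pv pw → suc-injective ∘ injective pv pw)
... | true  = suc-count-tail≤ g injective
  where
  p₀-true : T (p zero)
  p₀-true = Equivalence.from T-≡ p₀

  suc-count-tail≤ : ∀ {m} (g : ∀ v → T (p v) → Fin m) →
                    (∀ {v w} pv pw → g v pv ≡ g w pw → v ≡ w) →
                    suc (∑[ v < n ] (if p (suc v) then 1 else 0)) ≤ m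
  suc-count-tail≤ {zero}  g _         = contradiction (g zero p₀-true) ¬Fin0
  suc-count-tail≤ {suc m} g injective = s≤s (injective⇒count≤ (p ∘ suc) g′ injective′)
    where
    g₀≢g : ∀ {v} pv → g zero p₀-true ≢ g (suc v) pv
    g₀≢g pv eq with () ← injective p₀-true pv eq

    g′ : ∀ v → T (p (suc v)) → Fin m
    g′ v pv = punchOut (g₀≢g pv)

    injective′ : ∀ {v w} pv pw → g′ v pv ≡ g′ w pw → v ≡ w
    injective′ pv pw = suc-injective ∘ injective pv pw ∘ punchOut-injective (g₀≢g pv) (g₀≢g pw)

edgeColorable⇒degree≤ : ∀ {n m} (G : Graph n) → EdgeColorable G m → ∀ u → degree G u ≤ m
edgeColorable⇒degree≤ {n} {m} G (f , _ , proper) u = begin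
  degree G u                                ≡⟨ sum-map-tabulate (λ v → if adj G u v then 1 else 0) id ⟩
  ∑[ v < n ] (if adj G u v then 1 else 0)  ≤⟨ injective⇒count≤ (adj G u) (λ v _ → f u v) (proper u _ _) ⟩
  m                                         ∎
  where open ≤-Reasoning

maxDegree≤ : ∀ {n m} (G : Graph n) → (∀ u → degree G u ≤ m) → maxDegree G ≤ m
maxDegree≤ {m = m} G degree≤ =
  foldr-preservesᵇ {P = _≤ m} ⊔-lub z≤n (map⁺ (tabulate⁺ degree≤))

lemma2p2 : ∀ {n : ℕ} (G : Graph n) → InjChromaticNumberIs G (maxDegree G) → Class1 G
lemma2p2 G (injColorable , _) =
  injColorable⇒edgeColorable G injColorable ,
  λ m edgeColorable → maxDegree≤ G (edgeColorable⇒degree≤ G edgeColorable)
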